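{- Let $G$ be a graph with minimum degree $\delta > 0$ and maximum degree $\Delta$ with $2 \leq \Delta \leq 8$. Then $$GA_1(G) \geq \frac{2\Delta\sqrt{\delta\Delta}}{\delta+\Delta} + \frac{\Delta(\delta-1)}{2}.$$
   Context: All graphs are finite, simple (no loops or multiple edges) and have at least one edge. For a vertex $u$, $d_u$ denotes its degree. The geometric-arithmetic index of $G$ is $GA_1(G) = \sum_{uv \in E(G)} \frac{2\sqrt{d_u d_v}}{d_u + d_v}$. -}

module Defs where

open import Data.Bool using (Bool; true; false; if_then_else_)
open import Data.Nat as ℕ using (ℕ; zero; suc)
open import Data.Fin using (Fin; toℕ)
open import Data.Integer using (+_)
open import Data.Rational as ℚ using (ℚ; 0ℚ; _/_)
open import Data.Product using (Σ; _×_; ∃)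
open import Data.Sum using (_⊎_)
open import Relation.Binary.PropositionalEquality using (_≡_)
open import Relation.Nullary.Decidable using (⌊_⌋)

record Graph : Set where
  field
    n         : ℕ
    adj       : Fin n → Fin n → Bool
    adj-sym   : ∀ i j → adj i j ≡ adj j i
    adj-irrefl : ∀ i → adj i i ≡ false
open Graph public

ΣFin : (n : ℕ) → (Fin n → ℕ) → ℕ
ΣFin zero    f = 0
ΣFin (suc n) f = f Data.Fin.zero ℕ.+ ΣFin n (λ i → f (Data.Fin.suc i))

ΣFinℚ : (n : ℕ) → (Fin n → ℚ) → ℚ
ΣFinℚ zero    f = 0ℚ
ΣFinℚ (suc n) f = f Data.Fin.zero ℚ.+ ΣFinℚ n (λ i → f (Data.Fin.suc i))

deg : (G : Graph) → Fin (n G) → ℕ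
deg G v = ΣFin (n G) (λ w → if adj G v w then 1 else 0)

IsEdge : (G : Graph) → Fin (n G) → Fin (n G) → Bool
IsEdge G i j = if ⌊ toℕ i ℕ.<? toℕ j ⌋ then adj G i j else false

IsMinDegree : (G : Graph) → ℕ → Set
IsMinDegree G δ = (∀ v → δ ℕ.≤ deg G v) × ∃ λ v → deg G v ≡ δ

IsMaxDegree : (G : Graph) → ℕ → Set
IsMaxDegree G Δ = (∀ v → deg G v ℕ.≤ Δ) × ∃ λ v → deg G v ≡ Δ

ℕ→ℚ : ℕ → ℚ
ℕ→ℚ k = + k / 1

-- Real-number semantics without reals.
-- GA-term(u,v) = 2√(dᵤ dᵥ)/(dᵤ+dᵥ) ≥ 0.  A rational q is an upper bound of it
-- iff q ≥ 0 and q² (dᵤ+dᵥ)² ≥ 4 dᵤ dᵥ.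
UpperGATerm : ℕ → ℕ → ℚ → Set
UpperGATerm du dv q =
  (0ℚ ℚ.≤ q) × (ℕ→ℚ (4 ℕ.* du ℕ.* dv) ℚ.≤ q ℚ.* q ℚ.* ℕ→ℚ ((du ℕ.+ dv) ℕ.* (du ℕ.+ dv)))

EdgeSum : (G : Graph) → (Fin (n G) → Fin (n G) → ℚ) → ℚ
EdgeSum G u = ΣFinℚ (n G) (λ i → ΣFinℚ (n G) (λ j → if IsEdge G i j then u i j else 0ℚ))

UpperGA : (G : Graph) → (Fin (n G) → Fin (n G) → ℚ) → Set
UpperGA G u = ∀ i j → IsEdge G i j ≡ true → UpperGATerm (deg G i) (deg G j) (u i j)

-- "GA₁(G) ≥ x" for a real x described by its rational lower bounds LB :
-- every rational sum of edgewise upper bounds dominates every rational lower bound.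
GA≥ : (G : Graph) → (ℚ → Set) → Set
GA≥ G LB = ∀ (u : Fin (n G) → Fin (n G) → ℚ) → UpperGA G u → ∀ l → LB l → l ℚ.≤ EdgeSum G u

-- Rational lower bounds of  R = 2Δ√(δΔ)/(δ+Δ) + Δ(δ-1)/2 :
-- l ≤ R  iff  t ≤ 4Δ√(δΔ)/(δ+Δ) where t = 2l - Δ(δ-1),
-- iff  t < 0  or  t² (δ+Δ)² ≤ 16 Δ² δ Δ.
BoundLB : (δ Δ : ℕ) → ℚ → Set
BoundLB δ Δ l =
  let t = ℕ→ℚ 2 ℚ.* l ℚ.- ℕ→ℚ Δ ℚ.* (ℕ→ℚ δ ℚ.- ℕ→ℚ 1) in
  (t ℚ.< 0ℚ) ⊎ (t ℚ.* t ℚ.* ℕ→ℚ ((δ ℕ.+ Δ) ℕ.* (δ ℕ.+ Δ)) ℚ.≤ ℕ→ℚ (16 ℕ.* Δ ℕ.* Δ ℕ.* δ ℕ.* Δ))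

{-# OPTIONS --safe #-}
module Submission where

open import Defs
open import Algebra.Bundles using (CommutativeRing)
open import Data.Bool using (true; false; if_then_else_)
open import Data.Fin as Fin using (Fin; toℕ)
import Data.Fin.Properties as Fin
open import Data.Integer as ℤ using (+_; +≤+)
import Data.Integer.Properties as ℤ
open import Data.List using (upTo)
open import Data.List.Membership.Propositional.Properties using (∈-upTo⁺)
open import Data.List.Relation.Unary.All as All using (All; all?)
open import Data.Nat as ℕ using (ℕ; zero; suc; _≤_; _<_; s≤s; z≤n)
import Data.Nat.Coprimality as Coprime
import Data.Nat.Properties as ℕ
open import Data.Nat.Tactic.RingSolver using (solve-∀)
open import Data.Product using (_,_)
open import Data.Rational as ℚ using (ℚ; 0ℚ; 1ℚ; ½; mkℚ; *≤*)
import Data.Rational.Properties as ℚ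
open import Data.Rational.Solver using (module +-*-Solver)
open import Data.Sum as Sum using (_⊎_; inj₁; inj₂)
open import Data.Vec.Functional using (Vector)
open import Function using (_∘_)
open import Relation.Binary.PropositionalEquality
open import Relation.Nullary using (Dec; does; yes; no; contradiction)
open import Relation.Nullary.Decidable using (⌊_⌋; toWitness; _→-dec_; _⊎-dec_)

open import Algebra.Properties.Semiring.Sum (CommutativeRing.semiring ℚ.+-*-commutativeRing)
  using (sum; sum-syntax; sum-cong-≗; sum-replicate-zero; ∑-distrib-+; ∑-comm; *-distribˡ-sum)

-- Fix a vertex v of maximum degree Δ and write the target as l = Δ·p + Δ·(δ-1)/2.  Discharge
-- GA₁ onto the edges: v charges p to each of its edges, which is at most the GA term because
-- 2√(Δd)/(Δ+d) increases with d on [δ, Δ]; every other vertex i charges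
-- share(dᵢ) = (δ-1)/(2(dᵢ-1)) to each of its edges not leading to v, and
-- share(dᵢ) + share(dⱼ) ≤ 2√(dᵢdⱼ)/(dᵢ+dⱼ) holds for all degrees up to 8 (a finite check).
-- Collecting the charges by vertex, v contributes Δ·p, each of its Δ neighbours i contributes
-- share(dᵢ)·(dᵢ-1) = (δ-1)/2, and every other vertex contributes a nonnegative amount.

ℕ→ℚ≡mkℚ : ∀ k → ℕ→ℚ k ≡ mkℚ (+ k) 0 (Coprime.sym (Coprime.1-coprimeTo k))
ℕ→ℚ≡mkℚ k = ℚ.normalize-coprime (Coprime.sym (Coprime.1-coprimeTo k))

ℕ→ℚ-+ : ∀ a b → ℕ→ℚ (a ℕ.+ b) ≡ ℕ→ℚ a ℚ.+ ℕ→ℚ b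
ℕ→ℚ-+ a b rewrite ℕ→ℚ≡mkℚ a | ℕ→ℚ≡mkℚ b =
  cong (ℚ._/ 1) (trans (ℤ.pos-+ a b) (sym (cong₂ ℤ._+_ (ℤ.*-identityʳ (+ a)) (ℤ.*-identityʳ (+ b)))))

ℕ→ℚ-* : ∀ a b → ℕ→ℚ (a ℕ.* b) ≡ ℕ→ℚ a ℚ.* ℕ→ℚ b
ℕ→ℚ-* a b rewrite ℕ→ℚ≡mkℚ a | ℕ→ℚ≡mkℚ b = cong (ℚ._/ 1) (ℤ.pos-* a b)

ℕ→ℚ-mono-≤ : ∀ {a b} → a ≤ b → ℕ→ℚ a ℚ.≤ ℕ→ℚ b
ℕ→ℚ-mono-≤ {a} {b} a≤b rewrite ℕ→ℚ≡mkℚ a | ℕ→ℚ≡mkℚ b =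
  *≤* (subst₂ ℤ._≤_ (sym (ℤ.*-identityʳ (+ a))) (sym (ℤ.*-identityʳ (+ b))) (+≤+ a≤b))

ℕ→ℚ-nonNeg : ∀ a → 0ℚ ℚ.≤ ℕ→ℚ a
ℕ→ℚ-nonNeg a = ℕ→ℚ-mono-≤ {0} {a} z≤n

ℕ→ℚ-pos : ∀ {a} → 0 < a → 0ℚ ℚ.< ℕ→ℚ a
ℕ→ℚ-pos {suc k} _ = subst (0ℚ ℚ.<_) (sym (ℕ→ℚ≡mkℚ (suc k))) (ℚ.positive⁻¹ _)

1/ℕ : (n : ℕ) .{{_ : ℕ.NonZero n}} → ℚ
1/ℕ n = + 1 ℚ./ n

ℕ→ℚ-*-1/ℕ : ∀ n .{{_ : ℕ.NonZero n}} → ℕ→ℚ n ℚ.* 1/ℕ n ≡ 1ℚ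
ℕ→ℚ-*-1/ℕ (suc k) = trans
  (cong₂ ℚ._*_ (ℕ→ℚ≡mkℚ (suc k)) (ℚ.normalize-coprime (Coprime.1-coprimeTo (suc k))))
  (ℚ.*-inverseʳ (mkℚ (+ suc k) 0 (Coprime.sym (Coprime.1-coprimeTo (suc k)))))

ℕ→ℚ-∸1 : ∀ {a} → 0 < a → ℕ→ℚ (a ℕ.∸ 1) ≡ ℕ→ℚ a ℚ.- 1ℚ
ℕ→ℚ-∸1 {suc k} _ = begin
  ℕ→ℚ k                   ≡⟨ solve 1 (λ x → x := con 1ℚ :+ x :- con 1ℚ) refl (ℕ→ℚ k) ⟩
  1ℚ ℚ.+ ℕ→ℚ k ℚ.- 1ℚ     ≡⟨ cong (ℚ._- 1ℚ) (ℕ→ℚ-+ 1 k) ⟨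
  ℕ→ℚ (suc k) ℚ.- 1ℚ      ∎
  where
  open ≡-Reasoning
  open +-*-Solver

ℕ→ℚ-*-1/ℕ-double : ∀ a .{{_ : ℕ.NonZero (2 ℕ.* a)}} → ℕ→ℚ a ℚ.* 1/ℕ (2 ℕ.* a) ≡ ½
ℕ→ℚ-*-1/ℕ-double a = begin
  ℕ→ℚ a ℚ.* r
    ≡⟨ solve 2 (λ x r → x :* r := con ½ :* (con (ℕ→ℚ 2) :* x :* r)) refl (ℕ→ℚ a) r ⟩
  ½ ℚ.* (ℕ→ℚ 2 ℚ.* ℕ→ℚ a ℚ.* r)
    ≡⟨ cong (λ z → ½ ℚ.* (z ℚ.* r)) (ℕ→ℚ-* 2 a) ⟨
  ½ ℚ.* (ℕ→ℚ (2 ℕ.* a) ℚ.* r)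
    ≡⟨ cong (½ ℚ.*_) (ℕ→ℚ-*-1/ℕ (2 ℕ.* a)) ⟩
  ½ ℚ.* 1ℚ
    ≡⟨ ℚ.*-identityʳ ½ ⟩
  ½ ∎
  where
  open ≡-Reasoning
  open +-*-Solver
  r : ℚ
  r = 1/ℕ (2 ℕ.* a)

≤-from-squares : ∀ {s x k} → 0ℚ ℚ.≤ x → 0ℚ ℚ.< k → s ℚ.* s ℚ.* k ℚ.≤ x ℚ.* x ℚ.* k → s ℚ.≤ x
≤-from-squares {s} {x} {k} 0≤x 0<k s²k≤x²k with s ℚ.≤? x
... | yes s≤x = s≤x
... | no s≰x = contradiction (ℚ.<-≤-trans (ℚ.*-monoˡ-<-pos k x²<s²) s²k≤x²k) (ℚ.<-irrefl refl)
  where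
  x<s : x ℚ.< s
  x<s = ℚ.≰⇒> s≰x
  instance
    k-pos : ℚ.Positive k
    k-pos = ℚ.positive 0<k
    x-nonNeg : ℚ.NonNegative x
    x-nonNeg = ℚ.nonNegative 0≤x
    s-pos : ℚ.Positive s
    s-pos = ℚ.positive (ℚ.≤-<-trans 0≤x x<s)
  x²<s² : x ℚ.* x ℚ.< s ℚ.* s
  x²<s² = ℚ.≤-<-trans (ℚ.*-monoˡ-≤-nonNeg x (ℚ.<⇒≤ x<s)) (ℚ.*-monoˡ-<-pos s x<s)

*-nonNeg : ∀ {a b} → 0ℚ ℚ.≤ a → 0ℚ ℚ.≤ b → 0ℚ ℚ.≤ a ℚ.* b
*-nonNeg {a} {b} 0≤a 0≤b =
  ℚ.nonNegative⁻¹ _ {{ℚ.nonNeg*nonNeg⇒nonNeg a {{ℚ.nonNegative 0≤a}} b {{ℚ.nonNegative 0≤b}}}}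

-- Geometric–arithmetic terms

-- p ≤ 2√(ab)/(a+b), in the square-free form of UpperGATerm.
LowerGATerm : ℕ → ℕ → ℚ → Set
LowerGATerm a b p =
  p ℚ.≤ 0ℚ ⊎ p ℚ.* p ℚ.* ℕ→ℚ ((a ℕ.+ b) ℕ.* (a ℕ.+ b)) ℚ.≤ ℕ→ℚ (4 ℕ.* a ℕ.* b)

UpperGATerm-sym : ∀ {a b x} → UpperGATerm a b x → UpperGATerm b a x
UpperGATerm-sym {a} {b} {x} (0≤x , 4ab≤x²k) =
  0≤x , subst₂ (λ c k → ℕ→ℚ c ℚ.≤ x ℚ.* x ℚ.* ℕ→ℚ k)
               (4ab≡4ba a b) (cong (λ s → s ℕ.* s) (ℕ.+-comm a b)) 4ab≤x²k
  where
  4ab≡4ba : ∀ a b → 4 ℕ.* a ℕ.* b ≡ 4 ℕ.* b ℕ.* a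
  4ab≡4ba = solve-∀

LowerGATerm-≤-UpperGATerm : ∀ a b {p x} → 0 < a → LowerGATerm a b p → UpperGATerm a b x → p ℚ.≤ x
LowerGATerm-≤-UpperGATerm _ _ _ (inj₁ p≤0) (0≤x , _) = ℚ.≤-trans p≤0 0≤x
LowerGATerm-≤-UpperGATerm a b 0<a (inj₂ p²k≤c) (0≤x , c≤x²k) =
  ≤-from-squares 0≤x (ℕ→ℚ-pos (ℕ.*-mono-≤ 0<a+b 0<a+b)) (ℚ.≤-trans p²k≤c c≤x²k)
  where
  0<a+b : 0 < a ℕ.+ b
  0<a+b = ℕ.<-≤-trans 0<a (ℕ.m≤m+n a b)

GA²-mono-cross : ∀ {δ d Δ} → δ ≤ d → d ≤ Δ →
  4 ℕ.* δ ℕ.* Δ ℕ.* ((Δ ℕ.+ d) ℕ.* (Δ ℕ.+ d)) ≤ 4 ℕ.* Δ ℕ.* d ℕ.* ((δ ℕ.+ Δ) ℕ.* (δ ℕ.+ Δ))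
GA²-mono-cross {δ} δ≤d d≤Δ with ℕ.m≤n⇒∃[o]m+o≡n δ≤d | ℕ.m≤n⇒∃[o]m+o≡n d≤Δ
... | x , refl | y , refl = ℕ.≤-trans (ℕ.m≤m+n _ _) (ℕ.≤-reflexive (gap δ x y))
  where
  -- with d = δ + x and Δ = d + y, the difference of the two sides is 4Δx(Δ² - δd)
  gap : ∀ δ x y →
    let d = δ ℕ.+ x ; Δ = d ℕ.+ y in
    4 ℕ.* δ ℕ.* Δ ℕ.* ((Δ ℕ.+ d) ℕ.* (Δ ℕ.+ d))
      ℕ.+ 4 ℕ.* Δ ℕ.* x ℕ.* (x ℕ.* x ℕ.+ y ℕ.* y ℕ.+ δ ℕ.* x ℕ.+ 2 ℕ.* δ ℕ.* y ℕ.+ 2 ℕ.* x ℕ.* y)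
      ≡ 4 ℕ.* Δ ℕ.* d ℕ.* ((δ ℕ.+ Δ) ℕ.* (δ ℕ.+ Δ))
  gap = solve-∀

LowerGATerm-mono : ∀ {δ d Δ p} → 0 < δ → δ ≤ d → d ≤ Δ → LowerGATerm δ Δ p → LowerGATerm Δ d p
LowerGATerm-mono _ _ _ (inj₁ p≤0) = inj₁ p≤0
LowerGATerm-mono {δ} {d} {Δ} {p} 0<δ δ≤d d≤Δ (inj₂ p²K≤C) = inj₂ (ℚ.*-cancelʳ-≤-pos K (begin
  p ℚ.* p ℚ.* K′ ℚ.* K
    ≡⟨ swap p K′ K ⟩
  p ℚ.* p ℚ.* K ℚ.* K′
    ≤⟨ ℚ.*-monoʳ-≤-nonNeg K′ p²K≤C ⟩
  C ℚ.* K′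
    ≡⟨ ℕ→ℚ-* (4 ℕ.* δ ℕ.* Δ) _ ⟨
  ℕ→ℚ (4 ℕ.* δ ℕ.* Δ ℕ.* ((Δ ℕ.+ d) ℕ.* (Δ ℕ.+ d)))
    ≤⟨ ℕ→ℚ-mono-≤ (GA²-mono-cross δ≤d d≤Δ) ⟩
  ℕ→ℚ (4 ℕ.* Δ ℕ.* d ℕ.* ((δ ℕ.+ Δ) ℕ.* (δ ℕ.+ Δ)))
    ≡⟨ ℕ→ℚ-* (4 ℕ.* Δ ℕ.* d) _ ⟩
  C′ ℚ.* K ∎))
  where
  open ℚ.≤-Reasoning
  open +-*-Solver
  K K′ C C′ : ℚ
  K  = ℕ→ℚ ((δ ℕ.+ Δ) ℕ.* (δ ℕ.+ Δ))
  K′ = ℕ→ℚ ((Δ ℕ.+ d) ℕ.* (Δ ℕ.+ d))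
  C  = ℕ→ℚ (4 ℕ.* δ ℕ.* Δ)
  C′ = ℕ→ℚ (4 ℕ.* Δ ℕ.* d)
  0<δ+Δ : 0 < δ ℕ.+ Δ
  0<δ+Δ = ℕ.<-≤-trans 0<δ (ℕ.m≤m+n δ Δ)
  instance
    K-pos : ℚ.Positive K
    K-pos = ℚ.positive (ℕ→ℚ-pos (ℕ.*-mono-≤ 0<δ+Δ 0<δ+Δ))
    K′-nonNeg : ℚ.NonNegative K′
    K′-nonNeg = ℚ.nonNegative (ℕ→ℚ-nonNeg ((Δ ℕ.+ d) ℕ.* (Δ ℕ.+ d)))
  swap : ∀ p a b → p ℚ.* p ℚ.* a ℚ.* b ≡ p ℚ.* p ℚ.* b ℚ.* a
  swap = solve 3 (λ p a b → p :* p :* a :* b := p :* p :* b :* a) refl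

LowerGATerm-scale : ∀ {a b c t} .{{_ : ℕ.NonZero c}} →
  t ℚ.< 0ℚ ⊎ t ℚ.* t ℚ.* ℕ→ℚ ((a ℕ.+ b) ℕ.* (a ℕ.+ b)) ℚ.≤ ℕ→ℚ (c ℕ.* c ℕ.* (4 ℕ.* a ℕ.* b)) →
  LowerGATerm a b (t ℚ.* 1/ℕ c)
LowerGATerm-scale {a} {b} {c} {t} (inj₁ t<0) = inj₁ (begin
  t ℚ.* 1/ℕ c    ≤⟨ ℚ.*-monoʳ-≤-nonNeg (1/ℕ c) (ℚ.<⇒≤ t<0) ⟩
  0ℚ ℚ.* 1/ℕ c   ≡⟨ ℚ.*-zeroˡ (1/ℕ c) ⟩
  0ℚ             ∎)
  where
  open ℚ.≤-Reasoning
  instance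
    r-nonNeg : ℚ.NonNegative (1/ℕ c)
    r-nonNeg = ℚ.normalize-nonNeg 1 c
LowerGATerm-scale {a} {b} {c} {t} (inj₂ t²K≤c²C) = inj₂ (begin
  t ℚ.* r ℚ.* (t ℚ.* r) ℚ.* K
    ≡⟨ solve 3 (λ t r K → t :* r :* (t :* r) :* K := t :* t :* K :* (r :* r)) refl t r K ⟩
  t ℚ.* t ℚ.* K ℚ.* (r ℚ.* r)
    ≤⟨ ℚ.*-monoʳ-≤-nonNeg (r ℚ.* r) t²K≤c²C ⟩
  ℕ→ℚ (c ℕ.* c ℕ.* C′) ℚ.* (r ℚ.* r)
    ≡⟨ cong (ℚ._* (r ℚ.* r)) (trans (ℕ→ℚ-* (c ℕ.* c) C′) (cong (ℚ._* C) (ℕ→ℚ-* c c))) ⟩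
  N ℚ.* N ℚ.* C ℚ.* (r ℚ.* r)
    ≡⟨ solve 3 (λ N r C → N :* N :* C :* (r :* r) := N :* r :* (N :* r) :* C) refl N r C ⟩
  N ℚ.* r ℚ.* (N ℚ.* r) ℚ.* C
    ≡⟨ cong (λ e → e ℚ.* e ℚ.* C) (ℕ→ℚ-*-1/ℕ c) ⟩
  1ℚ ℚ.* 1ℚ ℚ.* C
    ≡⟨ ℚ.*-identityˡ C ⟩
  C ∎)
  where
  open ℚ.≤-Reasoning
  open +-*-Solver
  C′ : ℕ
  C′ = 4 ℕ.* a ℕ.* b
  r N K C : ℚ
  r = 1/ℕ c
  N = ℕ→ℚ c
  K = ℕ→ℚ ((a ℕ.+ b) ℕ.* (a ℕ.+ b))
  C = ℕ→ℚ C′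
  instance
    r-nonNeg : ℚ.NonNegative r
    r-nonNeg = ℚ.normalize-nonNeg 1 c
    r²-nonNeg : ℚ.NonNegative (r ℚ.* r)
    r²-nonNeg = ℚ.nonNeg*nonNeg⇒nonNeg r r

-- share δ d = (δ-1)/(2(d-1)) for d ≥ 2; d ≤ 1 only occurs with δ = 1, when every share is 0.
share : ℕ → ℕ → ℚ
share δ zero          = 0ℚ
share δ (suc zero)    = 0ℚ
share δ (suc (suc k)) = ℕ→ℚ (δ ℕ.∸ 1) ℚ.* ½ ℚ.* 1/ℕ (suc k)

share-nonNeg : ∀ δ a → 0ℚ ℚ.≤ share δ a
share-nonNeg δ zero          = ℚ.≤-refl
share-nonNeg δ (suc zero)    = ℚ.≤-refl
share-nonNeg δ (suc (suc k)) =
  *-nonNeg (*-nonNeg (ℕ→ℚ-nonNeg (δ ℕ.∸ 1)) (ℚ.≤ᵇ⇒≤ _))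
           (ℚ.nonNegative⁻¹ _ {{ℚ.normalize-nonNeg 1 (suc k)}})

share-*-pred : ∀ {δ a} → 0 < δ → δ ≤ a → share δ a ℚ.* (ℕ→ℚ a ℚ.- 1ℚ) ≡ ℕ→ℚ (δ ℕ.∸ 1) ℚ.* ½
share-*-pred {suc zero} {suc zero} _ _ = refl
share-*-pred {suc (suc _)} {suc zero} _ (s≤s ())
share-*-pred {δ} {suc (suc k)} _ _ = begin
  q ℚ.* r ℚ.* (ℕ→ℚ (1 ℕ.+ suc k) ℚ.- 1ℚ)
    ≡⟨ cong (λ e → q ℚ.* r ℚ.* (e ℚ.- 1ℚ)) (ℕ→ℚ-+ 1 (suc k)) ⟩
  q ℚ.* r ℚ.* (1ℚ ℚ.+ N ℚ.- 1ℚ)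
    ≡⟨ solve 3 (λ q r N → q :* r :* (con 1ℚ :+ N :- con 1ℚ) := q :* (N :* r)) refl q r N ⟩
  q ℚ.* (N ℚ.* r)
    ≡⟨ cong (q ℚ.*_) (ℕ→ℚ-*-1/ℕ (suc k)) ⟩
  q ℚ.* 1ℚ
    ≡⟨ ℚ.*-identityʳ q ⟩
  q ∎
  where
  open ≡-Reasoning
  open +-*-Solver
  q r N : ℚ
  q = ℕ→ℚ (δ ℕ.∸ 1) ℚ.* ½
  r = 1/ℕ (suc k)
  N = ℕ→ℚ (suc k)

lowerGATerm? : ∀ a b p → Dec (LowerGATerm a b p)
lowerGATerm? a b p = (p ℚ.≤? 0ℚ) ⊎-dec (_ ℚ.≤? _)

-- The only use of Δ ≤ 8: the bound fails for larger degrees, e.g. for δ = a = 2 and b = 30.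
share-sum-LowerGATerm : ∀ {δ a b} → 0 < δ → δ ≤ a → δ ≤ b → a ≤ 8 → b ≤ 8 →
  LowerGATerm a b (share δ a ℚ.+ share δ b)
share-sum-LowerGATerm 0<δ δ≤a δ≤b a≤8 b≤8 =
  All.lookup (All.lookup (All.lookup table (∈-upTo⁺ (s≤s (ℕ.≤-trans δ≤a a≤8))))
    (∈-upTo⁺ (s≤s a≤8))) (∈-upTo⁺ (s≤s b≤8)) 0<δ δ≤a δ≤b
  where
  table : All (λ δ → All (λ a → All (λ b → 0 < δ → δ ≤ a → δ ≤ b →
            LowerGATerm a b (share δ a ℚ.+ share δ b)) (upTo 9)) (upTo 9)) (upTo 9)
  table = toWitness {a? = all? (λ δ → all? (λ a → all? (λ b →
            (0 ℕ.<? δ) →-dec ((δ ℕ.≤? a) →-dec ((δ ℕ.≤? b) →-dec lowerGATerm? a b _))) _) _) _} _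

ΣFinℚ≡sum : ∀ n (f : Fin n → ℚ) → ΣFinℚ n f ≡ sum f
ΣFinℚ≡sum zero    f = refl
ΣFinℚ≡sum (suc n) f = cong (f Fin.zero ℚ.+_) (ΣFinℚ≡sum n (f ∘ Fin.suc))

ℕ→ℚ-ΣFin : ∀ n (f : Fin n → ℕ) → ℕ→ℚ (ΣFin n f) ≡ ∑[ i < n ] ℕ→ℚ (f i)
ℕ→ℚ-ΣFin zero    f = refl
ℕ→ℚ-ΣFin (suc n) f =
  trans (ℕ→ℚ-+ (f Fin.zero) _) (cong (ℕ→ℚ (f Fin.zero) ℚ.+_) (ℕ→ℚ-ΣFin n (f ∘ Fin.suc)))

sum-mono-≤ : ∀ {n} {f g : Vector ℚ n} → (∀ i → f i ℚ.≤ g i) → sum f ℚ.≤ sum g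
sum-mono-≤ {zero}  _   = ℚ.≤-refl
sum-mono-≤ {suc n} f≤g = ℚ.+-mono-≤ (f≤g Fin.zero) (sum-mono-≤ (f≤g ∘ Fin.suc))

sum-select : ∀ {n} (v : Fin n) (f : Vector ℚ n) →
  ∑[ i < n ] (if does (i Fin.≟ v) then f i else 0ℚ) ≡ f v
sum-select {suc n} Fin.zero    f = trans (cong (f Fin.zero ℚ.+_) (sum-replicate-zero n)) (ℚ.+-identityʳ _)
sum-select {suc n} (Fin.suc v) f = trans (ℚ.+-identityˡ _) (sum-select v (f ∘ Fin.suc))

∑∑-distrib-+ : ∀ {m n} (f g : Fin m → Fin n → ℚ) →
  ∑[ i < m ] ∑[ j < n ] (f i j ℚ.+ g i j) ≡ ∑[ i < m ] ∑[ j < n ] f i j ℚ.+ ∑[ i < m ] ∑[ j < n ] g i j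
∑∑-distrib-+ {n = n} f g = trans (sum-cong-≗ (λ i → ∑-distrib-+ (f i) (g i)))
  (∑-distrib-+ (λ i → ∑[ j < n ] f i j) (λ i → ∑[ j < n ] g i j))

if-+ : ∀ b (x y : ℚ) → (if b then x else 0ℚ) ℚ.+ (if b then y else 0ℚ) ≡ (if b then x ℚ.+ y else 0ℚ)
if-+ true  x y = refl
if-+ false x y = refl

if-mono-≤ : ∀ b {x y : ℚ} → (b ≡ true → x ℚ.≤ y) → (if b then x else 0ℚ) ℚ.≤ (if b then y else 0ℚ)
if-mono-≤ true  x≤y = x≤y refl
if-mono-≤ false _   = ℚ.≤-refl

sum-adj-const : ∀ G i c → ∑[ j < n G ] (if adj G i j then c else 0ℚ) ≡ c ℚ.* ℕ→ℚ (deg G i)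
sum-adj-const G i c = sym (begin
  c ℚ.* ℕ→ℚ (deg G i)
    ≡⟨ cong (c ℚ.*_) (ℕ→ℚ-ΣFin (n G) _) ⟩
  c ℚ.* ∑[ j < n G ] ℕ→ℚ (if adj G i j then 1 else 0)
    ≡⟨ *-distribˡ-sum c (λ j → ℕ→ℚ (if adj G i j then 1 else 0)) ⟩
  ∑[ j < n G ] (c ℚ.* ℕ→ℚ (if adj G i j then 1 else 0))
    ≡⟨ sum-cong-≗ (λ j → scale (adj G i j)) ⟩
  ∑[ j < n G ] (if adj G i j then c else 0ℚ) ∎)
  where
  open ≡-Reasoning
  scale : ∀ b → c ℚ.* ℕ→ℚ (if b then 1 else 0) ≡ (if b then c else 0ℚ)
  scale true  = ℚ.*-identityʳ c
  scale false = ℚ.*-zeroʳ c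

AdjSum : (G : Graph) → (Fin (n G) → Fin (n G) → ℚ) → ℚ
AdjSum G w = ∑[ i < n G ] ∑[ j < n G ] (if adj G i j then w i j else 0ℚ)

EdgeSum≡∑∑ : ∀ G w → EdgeSum G w ≡ ∑[ i < n G ] ∑[ j < n G ] (if IsEdge G i j then w i j else 0ℚ)
EdgeSum≡∑∑ G w = trans (ΣFinℚ≡sum (n G) (λ i → ΣFinℚ (n G) (E i))) (sum-cong-≗ (λ i → ΣFinℚ≡sum (n G) (E i)))
  where
  E : Fin (n G) → Fin (n G) → ℚ
  E i j = if IsEdge G i j then w i j else 0ℚ

EdgeSum-mono-≤ : ∀ G {w u} → (∀ i j → IsEdge G i j ≡ true → w i j ℚ.≤ u i j) → EdgeSum G w ℚ.≤ EdgeSum G u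
EdgeSum-mono-≤ G {w} {u} w≤u = subst₂ ℚ._≤_ (sym (EdgeSum≡∑∑ G w)) (sym (EdgeSum≡∑∑ G u))
  (sum-mono-≤ λ i → sum-mono-≤ λ j → if-mono-≤ (IsEdge G i j) (w≤u i j))

IsEdge⇒adj : ∀ G i j → IsEdge G i j ≡ true → adj G i j ≡ true
IsEdge⇒adj G i j with ⌊ toℕ i ℕ.<? toℕ j ⌋
... | true  = λ e → e
... | false = λ ()

adj-split : ∀ G i j (x : ℚ) →
  (if adj G i j then x else 0ℚ) ≡ (if IsEdge G i j then x else 0ℚ) ℚ.+ (if IsEdge G j i then x else 0ℚ)
adj-split G i j x with toℕ i ℕ.<? toℕ j | toℕ j ℕ.<? toℕ i
... | yes i<j | yes j<i = contradiction j<i (ℕ.<-asym i<j)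
... | yes _   | no  _   = sym (ℚ.+-identityʳ _)
... | no  _   | yes _   = trans (cong (λ b → if b then x else 0ℚ) (adj-sym G i j)) (sym (ℚ.+-identityˡ _))
... | no  i≮j | no  j≮i rewrite Fin.toℕ-injective (ℕ.≤∧≮⇒≡ (ℕ.≮⇒≥ j≮i) i≮j) | adj-irrefl G j = refl

EdgeSum-symmetrize : ∀ G w → EdgeSum G (λ i j → w i j ℚ.+ w j i) ≡ AdjSum G w
EdgeSum-symmetrize G w = begin
  EdgeSum G (λ i j → w i j ℚ.+ w j i)
    ≡⟨ EdgeSum≡∑∑ G _ ⟩
  ∑[ i < N ] ∑[ j < N ] E i j (w i j ℚ.+ w j i)
    ≡⟨ sum-cong-≗ (λ i → sum-cong-≗ (λ j → if-+ (IsEdge G i j) _ _)) ⟨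
  ∑[ i < N ] ∑[ j < N ] (E i j (w i j) ℚ.+ E i j (w j i))
    ≡⟨ ∑∑-distrib-+ (λ i j → E i j (w i j)) (λ i j → E i j (w j i)) ⟩
  ∑[ i < N ] ∑[ j < N ] E i j (w i j) ℚ.+ ∑[ i < N ] ∑[ j < N ] E i j (w j i)
    ≡⟨ cong (∑[ i < N ] ∑[ j < N ] E i j (w i j) ℚ.+_) (∑-comm (λ i j → E i j (w j i))) ⟩
  ∑[ i < N ] ∑[ j < N ] E i j (w i j) ℚ.+ ∑[ j < N ] ∑[ i < N ] E i j (w j i)
    ≡⟨ ∑∑-distrib-+ (λ i j → E i j (w i j)) (λ i j → E j i (w i j)) ⟨
  ∑[ i < N ] ∑[ j < N ] (E i j (w i j) ℚ.+ E j i (w i j))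
    ≡⟨ sum-cong-≗ (λ i → sum-cong-≗ (λ j → adj-split G i j (w i j))) ⟨
  AdjSum G w ∎
  where
  open ≡-Reasoning
  N : ℕ
  N = n G
  E : Fin N → Fin N → ℚ → ℚ
  E i j x = if IsEdge G i j then x else 0ℚ

-- Discharging

charge : ∀ {m} → Fin m → ℚ → (Fin m → ℚ) → Fin m → Fin m → ℚ
charge v p h i j = if does (i Fin.≟ v) then p else if does (j Fin.≟ v) then 0ℚ else h i

charge-edge-≤ : ∀ G v p h {u : Fin (n G) → Fin (n G) → ℚ} →
  (∀ i j → IsEdge G i j ≡ true → i ≡ v ⊎ j ≡ v → p ℚ.≤ u i j) →
  (∀ i j → IsEdge G i j ≡ true → h i ℚ.+ h j ℚ.≤ u i j) →
  ∀ i j → IsEdge G i j ≡ true → charge v p h i j ℚ.+ charge v p h j i ℚ.≤ u i j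
charge-edge-≤ G v p h {u} hub-≤ shares-≤ i j e with i Fin.≟ v | j Fin.≟ v
... | yes refl | yes refl = contradiction (trans (sym (IsEdge⇒adj G i i e)) (adj-irrefl G i)) λ ()
... | yes refl | no _    rewrite ℚ.+-identityʳ p = hub-≤ i j e (inj₁ refl)
... | no _    | yes refl rewrite ℚ.+-identityˡ p = hub-≤ i j e (inj₂ refl)
... | no _    | no _     = shares-≤ i j e

indicator-split : ∀ a b (c : ℚ) →
  (if a then (if b then 0ℚ else c) else 0ℚ) ℚ.+ (if b then (if a then c else 0ℚ) else 0ℚ) ≡ (if a then c else 0ℚ)
indicator-split true  true  c = ℚ.+-identityˡ c
indicator-split true  false c = ℚ.+-identityʳ c
indicator-split false true  c = refl
indicator-split false false c = refl

sum-adj-avoiding : ∀ G i v c →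
  ∑[ j < n G ] (if adj G i j then (if does (j Fin.≟ v) then 0ℚ else c) else 0ℚ) ℚ.+ (if adj G i v then c else 0ℚ)
    ≡ c ℚ.* ℕ→ℚ (deg G i)
sum-adj-avoiding G i v c = begin
  sum avoid ℚ.+ (if adj G i v then c else 0ℚ)
    ≡⟨ cong (sum avoid ℚ.+_) (sum-select v (λ j → if adj G i j then c else 0ℚ)) ⟨
  sum avoid ℚ.+ sum at
    ≡⟨ ∑-distrib-+ avoid at ⟨
  ∑[ j < n G ] (avoid j ℚ.+ at j)
    ≡⟨ sum-cong-≗ (λ j → indicator-split (adj G i j) (does (j Fin.≟ v)) c) ⟩
  ∑[ j < n G ] (if adj G i j then c else 0ℚ)
    ≡⟨ sum-adj-const G i c ⟩
  c ℚ.* ℕ→ℚ (deg G i) ∎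
  where
  open ≡-Reasoning
  avoid at : Fin (n G) → ℚ
  avoid j = if adj G i j then (if does (j Fin.≟ v) then 0ℚ else c) else 0ℚ
  at    j = if does (j Fin.≟ v) then (if adj G i j then c else 0ℚ) else 0ℚ

x+c≡cd⇒x≡c[d-1] : ∀ {x c d} → x ℚ.+ c ≡ c ℚ.* d → x ≡ c ℚ.* (d ℚ.- 1ℚ)
x+c≡cd⇒x≡c[d-1] {x} {c} {d} eq = begin
  x                 ≡⟨ solve 2 (λ x c → x := x :+ c :- c) refl x c ⟩
  x ℚ.+ c ℚ.- c     ≡⟨ cong (ℚ._- c) eq ⟩
  c ℚ.* d ℚ.- c     ≡⟨ solve 2 (λ c d → c :* d :- c := c :* (d :- con 1ℚ)) refl c d ⟩
  c ℚ.* (d ℚ.- 1ℚ)  ∎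
  where
  open ≡-Reasoning
  open +-*-Solver

charge-row-≥ : ∀ G v p q (h : Fin (n G) → ℚ) → (∀ i → 0ℚ ℚ.≤ h i) →
  (∀ i → adj G v i ≡ true → q ℚ.≤ h i ℚ.* (ℕ→ℚ (deg G i) ℚ.- 1ℚ)) →
  ∀ i → (if does (i Fin.≟ v) then p ℚ.* ℕ→ℚ (deg G v) else 0ℚ) ℚ.+ (if adj G v i then q else 0ℚ)
        ℚ.≤ ∑[ j < n G ] (if adj G i j then charge v p h i j else 0ℚ)
charge-row-≥ G v p q h h≥0 q≤h[d-1] i with i Fin.≟ v
... | yes refl rewrite adj-irrefl G i | ℚ.+-identityʳ (p ℚ.* ℕ→ℚ (deg G i)) =
  ℚ.≤-reflexive (sym (sum-adj-const G i p))
... | no _ = subst (ℚ._≤ _) (sym (ℚ.+-identityˡ _)) (near-hub-≤ (sum-adj-avoiding G i v (h i)))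
  where
  near-hub-≤ : ∀ {x} → x ℚ.+ (if adj G i v then h i else 0ℚ) ≡ h i ℚ.* ℕ→ℚ (deg G i) →
               (if adj G v i then q else 0ℚ) ℚ.≤ x
  near-hub-≤ {x} eq rewrite adj-sym G v i with adj G i v in i~v
  ... | true  = ℚ.≤-trans (q≤h[d-1] i (trans (adj-sym G v i) i~v)) (ℚ.≤-reflexive (sym (x+c≡cd⇒x≡c[d-1] eq)))
  ... | false = subst (0ℚ ℚ.≤_) (trans (sym eq) (ℚ.+-identityʳ x)) (*-nonNeg (h≥0 i) (ℕ→ℚ-nonNeg (deg G i)))

AdjSum-charge-≥ : ∀ G v p q (h : Fin (n G) → ℚ) → (∀ i → 0ℚ ℚ.≤ h i) →
  (∀ i → adj G v i ≡ true → q ℚ.≤ h i ℚ.* (ℕ→ℚ (deg G i) ℚ.- 1ℚ)) →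
  (p ℚ.+ q) ℚ.* ℕ→ℚ (deg G v) ℚ.≤ AdjSum G (charge v p h)
AdjSum-charge-≥ G v p q h h≥0 q≤h[d-1] = begin
  (p ℚ.+ q) ℚ.* D
    ≡⟨ ℚ.*-distribʳ-+ D p q ⟩
  p ℚ.* D ℚ.+ q ℚ.* D
    ≡⟨ cong₂ ℚ._+_ (sum-select v (λ _ → p ℚ.* D)) (sum-adj-const G v q) ⟨
  sum atHub ℚ.+ sum nearHub
    ≡⟨ ∑-distrib-+ atHub nearHub ⟨
  ∑[ i < n G ] (atHub i ℚ.+ nearHub i)
    ≤⟨ sum-mono-≤ (charge-row-≥ G v p q h h≥0 q≤h[d-1]) ⟩
  AdjSum G (charge v p h) ∎
  where
  open ℚ.≤-Reasoning
  D : ℚ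
  D = ℕ→ℚ (deg G v)
  atHub nearHub : Fin (n G) → ℚ
  atHub   i = if does (i Fin.≟ v) then p ℚ.* D else 0ℚ
  nearHub i = if adj G v i then q else 0ℚ

hubCharge : (δ Δ : ℕ) .{{_ : ℕ.NonZero (2 ℕ.* Δ)}} → ℚ → ℚ
hubCharge δ Δ l = (ℕ→ℚ 2 ℚ.* l ℚ.- ℕ→ℚ Δ ℚ.* (ℕ→ℚ δ ℚ.- ℕ→ℚ 1)) ℚ.* 1/ℕ (2 ℕ.* Δ)

BoundLB⇒LowerGATerm-hubCharge : ∀ δ Δ l .{{_ : ℕ.NonZero (2 ℕ.* Δ)}} →
  BoundLB δ Δ l → LowerGATerm δ Δ (hubCharge δ Δ l)
BoundLB⇒LowerGATerm-hubCharge δ Δ l =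
  LowerGATerm-scale {δ} {Δ} {2 ℕ.* Δ} ∘ Sum.map₂ (subst (λ k → t ℚ.* t ℚ.* K ℚ.≤ ℕ→ℚ k) (16ΔΔδΔ δ Δ))
  where
  t K : ℚ
  t = ℕ→ℚ 2 ℚ.* l ℚ.- ℕ→ℚ Δ ℚ.* (ℕ→ℚ δ ℚ.- ℕ→ℚ 1)
  K = ℕ→ℚ ((δ ℕ.+ Δ) ℕ.* (δ ℕ.+ Δ))
  16ΔΔδΔ : ∀ δ Δ → 16 ℕ.* Δ ℕ.* Δ ℕ.* δ ℕ.* Δ ≡ 2 ℕ.* Δ ℕ.* (2 ℕ.* Δ) ℕ.* (4 ℕ.* δ ℕ.* Δ)
  16ΔΔδΔ = solve-∀

hubCharge-split : ∀ {δ} Δ l .{{_ : ℕ.NonZero (2 ℕ.* Δ)}} → 0 < δ →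
  l ≡ (hubCharge δ Δ l ℚ.+ ℕ→ℚ (δ ℕ.∸ 1) ℚ.* ½) ℚ.* ℕ→ℚ Δ
hubCharge-split {δ} Δ l 0<δ = begin
  l
    ≡⟨ solve 3 (λ l D e → l := (con (ℕ→ℚ 2) :* l :- D :* e) :* con ½ :+ e :* con ½ :* D) refl l D e ⟩
  s ℚ.* ½ ℚ.+ q ℚ.* D
    ≡⟨ cong (λ z → s ℚ.* z ℚ.+ q ℚ.* D) (ℕ→ℚ-*-1/ℕ-double Δ) ⟨
  s ℚ.* (D ℚ.* r) ℚ.+ q ℚ.* D
    ≡⟨ solve 4 (λ s D r q → s :* (D :* r) :+ q :* D := (s :* r :+ q) :* D) refl s D r q ⟩
  (s ℚ.* r ℚ.+ q) ℚ.* D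
    ≡⟨ cong (λ e′ → ((ℕ→ℚ 2 ℚ.* l ℚ.- D ℚ.* e′) ℚ.* r ℚ.+ q) ℚ.* D) (ℕ→ℚ-∸1 0<δ) ⟩
  (hubCharge δ Δ l ℚ.+ q) ℚ.* D ∎
  where
  open ≡-Reasoning
  open +-*-Solver
  D e q s r : ℚ
  D = ℕ→ℚ Δ
  e = ℕ→ℚ (δ ℕ.∸ 1)
  q = e ℚ.* ½
  s = ℕ→ℚ 2 ℚ.* l ℚ.- D ℚ.* e
  r = 1/ℕ (2 ℕ.* Δ)

hub-edge-≥ : ∀ G {δ Δ p u} v → 0 < δ → (∀ i → δ ≤ deg G i) → (∀ i → deg G i ≤ Δ) → deg G v ≡ Δ →
  LowerGATerm δ Δ p → UpperGA G u → ∀ i j → IsEdge G i j ≡ true → i ≡ v ⊎ j ≡ v → p ℚ.≤ u i j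
hub-edge-≥ G {δ} {Δ} {p} {u} v 0<δ δ≤deg deg≤Δ deg-v≡Δ p-low u-upper = hub-≤
  where
  0<Δ : 0 < Δ
  0<Δ = subst (0 <_) deg-v≡Δ (ℕ.<-≤-trans 0<δ (δ≤deg v))
  below : ∀ {x} j → UpperGATerm Δ (deg G j) x → p ℚ.≤ x
  below j = LowerGATerm-≤-UpperGATerm Δ (deg G j) 0<Δ (LowerGATerm-mono 0<δ (δ≤deg j) (deg≤Δ j) p-low)
  hub-≤ : ∀ i j → IsEdge G i j ≡ true → i ≡ v ⊎ j ≡ v → p ℚ.≤ u i j
  hub-≤ i j e (inj₁ refl) = below j (subst (λ d → UpperGATerm d (deg G j) (u i j)) deg-v≡Δ (u-upper i j e))
  hub-≤ i j e (inj₂ refl) = below i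
    (subst (λ d → UpperGATerm d (deg G i) (u i j)) deg-v≡Δ (UpperGATerm-sym {deg G i} {deg G j} (u-upper i j e)))

share-edge-≥ : ∀ G {δ u} → 0 < δ → (∀ i → δ ≤ deg G i) → (∀ i → deg G i ≤ 8) → UpperGA G u →
  ∀ i j → IsEdge G i j ≡ true → share δ (deg G i) ℚ.+ share δ (deg G j) ℚ.≤ u i j
share-edge-≥ G 0<δ δ≤deg deg≤8 u-upper i j e =
  LowerGATerm-≤-UpperGATerm (deg G i) (deg G j) (ℕ.<-≤-trans 0<δ (δ≤deg i))
    (share-sum-LowerGATerm 0<δ (δ≤deg i) (δ≤deg j) (deg≤8 i) (deg≤8 j)) (u-upper i j e)

corollary2p17 : (G : Graph) (δ Δ : ℕ) → IsMinDegree G δ → IsMaxDegree G Δ →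
    0 < δ → 2 ≤ Δ → Δ ≤ 8 → GA≥ G (BoundLB δ Δ)
corollary2p17 G δ Δ (δ≤deg , _) (deg≤Δ , v , deg-v≡Δ) 0<δ 2≤Δ Δ≤8 u u-upper l l-bound = begin
  l                                  ≡⟨ hubCharge-split Δ l 0<δ ⟩
  (p ℚ.+ q) ℚ.* ℕ→ℚ Δ                ≡⟨ cong (λ d → (p ℚ.+ q) ℚ.* ℕ→ℚ d) deg-v≡Δ ⟨
  (p ℚ.+ q) ℚ.* ℕ→ℚ (deg G v)        ≤⟨ AdjSum-charge-≥ G v p q h (share-nonNeg δ ∘ deg G) q≤h[d-1] ⟩
  AdjSum G (charge v p h)            ≡⟨ EdgeSum-symmetrize G (charge v p h) ⟨
  EdgeSum G (λ i j → charge v p h i j ℚ.+ charge v p h j i)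
                                     ≤⟨ EdgeSum-mono-≤ G (charge-edge-≤ G v p h hub-≤ shares-≤) ⟩
  EdgeSum G u                        ∎
  where
  open ℚ.≤-Reasoning
  instance
    2Δ≢0 : ℕ.NonZero (2 ℕ.* Δ)
    2Δ≢0 = ℕ.>-nonZero (ℕ.≤-trans (s≤s z≤n) (ℕ.≤-trans 2≤Δ (ℕ.m≤n*m Δ 2)))
  p q : ℚ
  p = hubCharge δ Δ l
  q = ℕ→ℚ (δ ℕ.∸ 1) ℚ.* ½
  h : Fin (n G) → ℚ
  h i = share δ (deg G i)
  hub-≤ : ∀ i j → IsEdge G i j ≡ true → i ≡ v ⊎ j ≡ v → p ℚ.≤ u i j
  hub-≤ = hub-edge-≥ G v 0<δ δ≤deg deg≤Δ deg-v≡Δ (BoundLB⇒LowerGATerm-hubCharge δ Δ l l-bound) u-upper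
  shares-≤ : ∀ i j → IsEdge G i j ≡ true → h i ℚ.+ h j ℚ.≤ u i j
  shares-≤ = share-edge-≥ G 0<δ δ≤deg (λ i → ℕ.≤-trans (deg≤Δ i) Δ≤8) u-upper
  q≤h[d-1] : ∀ i → adj G v i ≡ true → q ℚ.≤ h i ℚ.* (ℕ→ℚ (deg G i) ℚ.- 1ℚ)
  q≤h[d-1] i _ = ℚ.≤-reflexive (sym (share-*-pred 0<δ (δ≤deg i)))
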